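{- There exist absolute constants $C,C'>0$ such that the following holds for all integers $l\ge 1$ and $m\ge 1$. There is a number $\gamma_{l,m}>0$ with $\bigl|\gamma_{l,m}^{ -1}-1\bigr|\le C'/l$, i.e. $\gamma_{l,m}=(1+O(1/l))^{ -1}$, such that for every integer $n$ with $0\le n\le ml$, \[ P[X_{l,m}=n]=\gamma_{l,m}\,P[S^{(m)}_l=n]+e_{l,m}(n), \] where the error term satisfies \[ 0\le e_{l,m}(n)\le C\,l^{ -2}. \]
   Context: $h_{l,m}(n)$ is the number of tuples $(\pi_1,\dots,\pi_k)$ with $1\le k\le m$ and integers $0\le\pi_j\le l$ such that $\pi_1+\dots+\pi_k=n$. $X_{l,m}$ is the random variable taking the value $n\in\{0,\dots,lm\}$ with probability $\frac{h_{l,m}(n)}{\sum_{i=0}^{lm}h_{l,m}(i)}$. $S^{(m)}_l=S_1+\dots+S_m$, where $S_1,\dots,S_m$ are independent random variables, each uniformly distributed on $\{0,1,\dots,l\}$. -}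

module Defs where

open import Data.Nat as ℕ using (ℕ; zero; suc; _+_; _*_; _^_; _≟_)
open import Data.Fin using (Fin; toℕ)
open import Data.Nat.ListAction using (sum)
open import Data.List using (List; []; _∷_; map; concatMap; filter; length; allFin; upTo)
open import Data.Vec using (Vec; []; _∷_; toList)
open import Data.Integer using (+_)
open import Data.Rational using (ℚ; _/_; 0ℚ)

tuples : (l k : ℕ) → List (Vec (Fin (suc l)) k)
tuples l zero = [] ∷ []
tuples l (suc k) = concatMap (λ i → map (i ∷_) (tuples l k)) (allFin (suc l))

tupleSum : ∀ {l k} → Vec (Fin (suc l)) k → ℕ
tupleSum v = sum (map toℕ (toList v))

countLen : (l k n : ℕ) → ℕ
countLen l k n = length (filter (λ v → tupleSum v ≟ n) (tuples l k))

h : (l m n : ℕ) → ℕ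
h l m n = sum (map (λ j → countLen l (suc j) n) (upTo m))

-- a / b as a rational; the b = 0 branch is never used below (all denominators are positive)
frac : ℕ → ℕ → ℚ
frac a zero = 0ℚ
frac a (suc b) = (+ a) / suc b

probX : (l m n : ℕ) → ℚ
probX l m n = frac (h l m n) (sum (map (h l m) (upTo (suc (l * m)))))

probS : (l m n : ℕ) → ℚ
probS l m n = frac (countLen l m n) (suc l ^ m)

module Submission where

-- Write q = l + 1 and count tuples by their length k.  There are q^k tuples of length k, so the total
-- mass is D = q + q² + ⋯ + q^m, and the tuples of the top length m contribute countLen l m n = q^m P[S = n].
-- Hence with γ = q^m / D the difference P[X = n] − γ P[S = n] is R(n) / D, where R(n) counts the shorter
-- tuples with sum n.  Fixing all entries but the first shows that at most q^(k−1) tuples of length k have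
-- a given sum, so R(n) ≤ 1 + q + ⋯ + q^(m−2) < q^(m−1) / l and R(n) / D ≤ 1 / l²; likewise
-- 1/γ − 1 = (q + ⋯ + q^(m−1)) / q^m < 1 / l.  Both constants can therefore be taken to be 1.

open import Defs
open import Data.Nat using (ℕ)

module Sums where
  open import Data.Nat using (ℕ; zero; suc; _+_; _*_; _^_; _≤_; _<_; z≤n; s≤s)
  open import Data.Nat.Properties
    using (+-identityʳ; +-mono-≤; *-zeroʳ; *-distribˡ-+; +-commutativeSemigroup; suc-injective; ≤-reflexive; 0≢1+n)
  open import Data.Nat.ListAction using (sum)
  open import Data.Nat.ListAction.Properties using (sum-++)
  open import Data.List using (List; []; _∷_; [_]; _++_; _∷ʳ_; map; concatMap; filter; length; applyUpTo)
  open import Data.List.Properties using (applyUpTo-∷ʳ)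
  open import Data.Empty using (⊥-elim)
  open import Relation.Nullary using (Dec; yes; no; ¬_)
  open import Relation.Unary using (Decidable)
  open import Relation.Binary.PropositionalEquality using (_≡_; refl; sym; trans; cong; cong₂; module ≡-Reasoning)
  open import Algebra.Properties.CommutativeSemigroup +-commutativeSemigroup using (interchange)
  open import Function using (_∘_)
  open ≡-Reasoning

  ∑< : ℕ → (ℕ → ℕ) → ℕ
  ∑< N f = sum (applyUpTo f N)

  syntax ∑< N (λ i → e) = ∑[ i < N ] e

  𝟙 : {P : Set} → Dec P → ℕ
  𝟙 (yes _) = 1
  𝟙 (no _) = 0

  module _ {A : Set} where

    sum-map-mono : ∀ {f g : A → ℕ} → (∀ x → f x ≤ g x) → ∀ xs → sum (map f xs) ≤ sum (map g xs)
    sum-map-mono f≤g [] = z≤n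
    sum-map-mono f≤g (x ∷ xs) = +-mono-≤ (f≤g x) (sum-map-mono f≤g xs)

    sum-map-const : ∀ c (xs : List A) → sum (map (λ _ → c) xs) ≡ length xs * c
    sum-map-const c [] = refl
    sum-map-const c (x ∷ xs) = cong (c +_) (sum-map-const c xs)

    sum-map-+ : ∀ (f g : A → ℕ) xs → sum (map (λ x → f x + g x) xs) ≡ sum (map f xs) + sum (map g xs)
    sum-map-+ f g [] = refl
    sum-map-+ f g (x ∷ xs) = begin
      f x + g x + sum (map (λ x → f x + g x) xs)      ≡⟨ cong (f x + g x +_) (sum-map-+ f g xs) ⟩
      f x + g x + (sum (map f xs) + sum (map g xs))  ≡⟨ interchange (f x) (g x) _ _ ⟩
      f x + sum (map f xs) + (g x + sum (map g xs))  ∎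

    length-filter≡sum-𝟙 : ∀ {P : A → Set} (P? : Decidable P) xs → length (filter P? xs) ≡ sum (map (𝟙 ∘ P?) xs)
    length-filter≡sum-𝟙 P? [] = refl
    length-filter≡sum-𝟙 P? (x ∷ xs) with P? x
    ... | yes _ = cong suc (length-filter≡sum-𝟙 P? xs)
    ... | no _ = length-filter≡sum-𝟙 P? xs

  module _ {A B : Set} where

    sum-map-swap : ∀ (f : A → B → ℕ) xs ys →
      sum (map (λ x → sum (map (f x) ys)) xs) ≡ sum (map (λ y → sum (map (λ x → f x y) xs)) ys)
    sum-map-swap f [] ys = sym (trans (sum-map-const 0 ys) (*-zeroʳ (length ys)))
    sum-map-swap f (x ∷ xs) ys = begin
      sum (map (f x) ys) + sum (map (λ x → sum (map (f x) ys)) xs)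
        ≡⟨ cong (sum (map (f x) ys) +_) (sum-map-swap f xs ys) ⟩
      sum (map (f x) ys) + sum (map (λ y → sum (map (λ x → f x y) xs)) ys)
        ≡⟨ sum-map-+ (f x) (λ y → sum (map (λ x → f x y) xs)) ys ⟨
      sum (map (λ y → sum (map (λ x → f x y) (x ∷ xs))) ys) ∎

    sum-map-concatMap : ∀ (g : B → ℕ) (f : A → List B) xs →
      sum (map g (concatMap f xs)) ≡ sum (map (λ x → sum (map g (f x))) xs)
    sum-map-concatMap g f [] = refl
    sum-map-concatMap g f (x ∷ xs) = begin
      sum (map g (f x ++ concatMap f xs))
        ≡⟨ cong sum (map-++ g (f x) (concatMap f xs)) ⟩
      sum (map g (f x) ++ map g (concatMap f xs))
        ≡⟨ sum-++ (map g (f x)) _ ⟩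
      sum (map g (f x)) + sum (map g (concatMap f xs))
        ≡⟨ cong (sum (map g (f x)) +_) (sum-map-concatMap g f xs) ⟩
      sum (map g (f x)) + sum (map (λ x → sum (map g (f x))) xs) ∎
      where open import Data.List.Properties using (map-++)

  ∑<-suc : ∀ (f : ℕ → ℕ) N → ∑[ i < suc N ] f i ≡ ∑[ i < N ] f i + f N
  ∑<-suc f N = begin
    sum (applyUpTo f (suc N))         ≡⟨ cong sum (applyUpTo-∷ʳ f N) ⟨
    sum (applyUpTo f N ∷ʳ f N)        ≡⟨ sum-++ (applyUpTo f N) [ f N ] ⟩
    sum (applyUpTo f N) + (f N + 0)   ≡⟨ cong (sum (applyUpTo f N) +_) (+-identityʳ (f N)) ⟩
    sum (applyUpTo f N) + f N         ∎

  ∑<-cong : ∀ {f g : ℕ → ℕ} N → (∀ {i} → i < N → f i ≡ g i) → ∑[ i < N ] f i ≡ ∑[ i < N ] g i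
  ∑<-cong zero f≡g = refl
  ∑<-cong (suc N) f≡g = cong₂ _+_ (f≡g (s≤s z≤n)) (∑<-cong N (f≡g ∘ s≤s))

  ∑<-mono : ∀ {f g : ℕ → ℕ} N → (∀ i → f i ≤ g i) → ∑[ i < N ] f i ≤ ∑[ i < N ] g i
  ∑<-mono zero f≤g = z≤n
  ∑<-mono (suc N) f≤g = +-mono-≤ (f≤g 0) (∑<-mono N (f≤g ∘ suc))

  ∑<-*ˡ : ∀ k (f : ℕ → ℕ) N → ∑[ i < N ] (k * f i) ≡ k * (∑[ i < N ] f i)
  ∑<-*ˡ k f zero = sym (*-zeroʳ k)
  ∑<-*ˡ k f (suc N) = trans (cong (k * f 0 +_) (∑<-*ˡ k (f ∘ suc) N)) (sym (*-distribˡ-+ k (f 0) _))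

  ∑𝟙-none : ∀ {P : ℕ → Set} (P? : Decidable P) N → (∀ {i} → i < N → ¬ P i) → ∑[ i < N ] 𝟙 (P? i) ≡ 0
  ∑𝟙-none P? zero ¬P = refl
  ∑𝟙-none P? (suc N) ¬P with P? 0
  ... | yes p = ⊥-elim (¬P (s≤s z≤n) p)
  ... | no _ = ∑𝟙-none (P? ∘ suc) N (¬P ∘ s≤s)

  ∑𝟙-≤1 : ∀ {P : ℕ → Set} (P? : Decidable P) N → (∀ {i j} → P i → P j → i ≡ j) → ∑[ i < N ] 𝟙 (P? i) ≤ 1
  ∑𝟙-≤1 P? zero uniq = z≤n
  ∑𝟙-≤1 P? (suc N) uniq with P? 0
  ... | yes p = s≤s (≤-reflexive (∑𝟙-none (P? ∘ suc) N (λ _ q → 0≢1+n (uniq p q))))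
  ... | no _ = ∑𝟙-≤1 (P? ∘ suc) N (λ p q → suc-injective (uniq p q))

  ∑𝟙-≡1 : ∀ {P : ℕ → Set} (P? : Decidable P) N → (∀ {i j} → P i → P j → i ≡ j) →
    ∀ {k} → k < N → P k → ∑[ i < N ] 𝟙 (P? i) ≡ 1
  ∑𝟙-≡1 P? (suc N) uniq {k} k<N Pk with P? 0
  ... | yes p = cong suc (∑𝟙-none (P? ∘ suc) N (λ _ q → 0≢1+n (uniq p q)))
  ∑𝟙-≡1 P? (suc N) uniq {zero} k<N Pk | no ¬p = ⊥-elim (¬p Pk)
  ∑𝟙-≡1 P? (suc N) uniq {suc k} (s≤s k<N) Pk | no _ = ∑𝟙-≡1 (P? ∘ suc) N (λ p q → suc-injective (uniq p q)) k<N Pk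

  geometric-sum : ∀ l N → suc (l * (∑[ j < N ] (suc l ^ j))) ≡ suc l ^ N
  geometric-sum l zero = cong suc (*-zeroʳ l)
  geometric-sum l (suc N) = begin
    suc (l * (∑[ j < suc N ] (suc l ^ j)))            ≡⟨ cong (λ s → suc (l * s)) (∑<-suc (suc l ^_) N) ⟩
    suc (l * (∑[ j < N ] (suc l ^ j) + suc l ^ N))  ≡⟨ cong suc (*-distribˡ-+ l _ _) ⟩
    suc (l * (∑[ j < N ] (suc l ^ j))) + l * suc l ^ N ≡⟨ cong (_+ l * suc l ^ N) (geometric-sum l N) ⟩
    suc l ^ suc N                                 ∎

module Tuples where
  open Sums
  open import Data.Nat using (ℕ; zero; suc; _+_; _*_; _^_; _≤_; _<_; _≟_; z≤n; s≤s)
  open import Data.Nat.Properties using (+-mono-≤; +-cancelʳ-≡; *-monoˡ-≤; *-comm; ≤-trans; ≤-reflexive; ≤-<-trans; module ≤-Reasoning)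
  open import Data.Nat.ListAction using (sum)
  open import Data.Fin using (Fin; toℕ)
  open import Data.Fin.Properties using (toℕ≤pred[n])
  open import Data.List using (_∷_; length; map; allFin; upTo; applyUpTo; tabulate)
  open import Data.List.Properties using (map-cong; map-∘; map-tabulate; map-upTo; length-tabulate)
  open import Data.Vec using (Vec; []; _∷_)
  open import Relation.Binary.PropositionalEquality using (_≡_; refl; sym; trans; cong; cong₂; module ≡-Reasoning)
  open import Function using (_∘_; id)

  sum-map-allFin : ∀ N (f : ℕ → ℕ) → sum (map (f ∘ toℕ) (allFin N)) ≡ ∑[ a < N ] f a
  sum-map-allFin N f = cong sum (trans (map-tabulate id (f ∘ toℕ)) (tabulate-toℕ N f))
    where
    tabulate-toℕ : ∀ N (f : ℕ → ℕ) → tabulate {n = N} (f ∘ toℕ) ≡ applyUpTo f N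
    tabulate-toℕ zero f = refl
    tabulate-toℕ (suc N) f = cong (f 0 ∷_) (tabulate-toℕ N (f ∘ suc))

  module _ (l : ℕ) where

    sum-map-tuples-suc : ∀ k (g : Vec (Fin (suc l)) (suc k) → ℕ) →
      sum (map g (tuples l (suc k))) ≡ sum (map (λ i → sum (map (λ v → g (i ∷ v)) (tuples l k))) (allFin (suc l)))
    sum-map-tuples-suc k g = trans (sum-map-concatMap g (λ i → map (i ∷_) (tuples l k)) (allFin (suc l)))
      (cong sum (map-cong (λ i → cong sum (sym (map-∘ (tuples l k)))) (allFin (suc l))))

    sum-ones-tuples : ∀ k → sum (map (λ _ → 1) (tuples l k)) ≡ suc l ^ k
    sum-ones-tuples zero = refl
    sum-ones-tuples (suc k) = begin
      sum (map (λ _ → 1) (tuples l (suc k)))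
        ≡⟨ sum-map-tuples-suc k (λ _ → 1) ⟩
      sum (map (λ _ → sum (map (λ _ → 1) (tuples l k))) (allFin (suc l)))
        ≡⟨ sum-map-const _ (allFin (suc l)) ⟩
      length (allFin (suc l)) * sum (map (λ _ → 1) (tuples l k))
        ≡⟨ cong₂ _*_ (length-tabulate {n = suc l} id) (sum-ones-tuples k) ⟩
      suc l * suc l ^ k ∎
      where open ≡-Reasoning

    tupleSum-≤ : ∀ {k} (v : Vec (Fin (suc l)) k) → tupleSum v ≤ k * l
    tupleSum-≤ [] = z≤n
    tupleSum-≤ (i ∷ v) = +-mono-≤ (toℕ≤pred[n] i) (tupleSum-≤ v)

    countLen≡sum-𝟙 : ∀ k n → countLen l k n ≡ sum (map (λ v → 𝟙 (tupleSum v ≟ n)) (tuples l k))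
    countLen≡sum-𝟙 k n = length-filter≡sum-𝟙 (λ v → tupleSum v ≟ n) (tuples l k)

    -- Once the last k entries are fixed, at most one value of the first entry hits the target sum.
    countLen-suc-≤ : ∀ k n → countLen l (suc k) n ≤ suc l ^ k
    countLen-suc-≤ k n = begin
      countLen l (suc k) n
        ≡⟨ countLen≡sum-𝟙 (suc k) n ⟩
      sum (map (λ v → 𝟙 (tupleSum v ≟ n)) (tuples l (suc k)))
        ≡⟨ sum-map-tuples-suc k (λ v → 𝟙 (tupleSum v ≟ n)) ⟩
      sum (map (λ i → sum (map (λ v → 𝟙 (toℕ i + tupleSum v ≟ n)) (tuples l k))) (allFin (suc l)))
        ≡⟨ sum-map-swap (λ i v → 𝟙 (toℕ i + tupleSum v ≟ n)) (allFin (suc l)) (tuples l k) ⟩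
      sum (map (λ v → sum (map (λ i → 𝟙 (toℕ i + tupleSum v ≟ n)) (allFin (suc l)))) (tuples l k))
        ≡⟨ cong sum (map-cong (λ v → sum-map-allFin (suc l) (λ a → 𝟙 (a + tupleSum v ≟ n))) (tuples l k)) ⟩
      sum (map (λ v → ∑[ a < suc l ] 𝟙 (a + tupleSum v ≟ n)) (tuples l k))
        ≤⟨ sum-map-mono (λ v → ∑𝟙-≤1 (λ a → a + tupleSum v ≟ n) (suc l)
                                 (λ p q → +-cancelʳ-≡ (tupleSum v) _ _ (trans p (sym q)))) (tuples l k) ⟩
      sum (map (λ _ → 1) (tuples l k))
        ≡⟨ sum-ones-tuples k ⟩
      suc l ^ k ∎
      where open ≤-Reasoning

    sum-countLen : ∀ k N → k * l < N → sum (map (countLen l k) (upTo N)) ≡ suc l ^ k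
    sum-countLen k N kl<N = begin
      sum (map (countLen l k) (upTo N))
        ≡⟨ cong sum (map-cong (countLen≡sum-𝟙 k) (upTo N)) ⟩
      sum (map (λ n → sum (map (λ v → 𝟙 (tupleSum v ≟ n)) (tuples l k))) (upTo N))
        ≡⟨ sum-map-swap (λ n v → 𝟙 (tupleSum v ≟ n)) (upTo N) (tuples l k) ⟩
      sum (map (λ v → sum (map (λ n → 𝟙 (tupleSum v ≟ n)) (upTo N))) (tuples l k))
        ≡⟨ cong sum (map-cong (λ v → trans (cong sum (map-upTo _ N))
             (∑𝟙-≡1 (λ n → tupleSum v ≟ n) N (λ p q → trans (sym p) q)
               (≤-<-trans (tupleSum-≤ v) kl<N) refl)) (tuples l k)) ⟩
      sum (map (λ _ → 1) (tuples l k))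
        ≡⟨ sum-ones-tuples k ⟩
      suc l ^ k ∎
      where open ≡-Reasoning

    h-split-last : ∀ m n → h l (suc m) n ≡ ∑[ j < m ] countLen l (suc j) n + countLen l (suc m) n
    h-split-last m n = trans (cong sum (map-upTo _ (suc m))) (∑<-suc (λ j → countLen l (suc j) n) m)

    sum-h : ∀ m → sum (map (h l m) (upTo (suc (l * m)))) ≡ ∑[ j < m ] (suc l ^ suc j)
    sum-h m = begin
      sum (map (h l m) (upTo (suc (l * m))))
        ≡⟨ sum-map-swap (λ n j → countLen l (suc j) n) (upTo (suc (l * m))) (upTo m) ⟩
      sum (map (λ j → sum (map (countLen l (suc j)) (upTo (suc (l * m))))) (upTo m))
        ≡⟨ cong sum (map-upTo _ m) ⟩
      ∑[ j < m ] sum (map (countLen l (suc j)) (upTo (suc (l * m))))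
        ≡⟨ ∑<-cong m (λ {j} j<m → sum-countLen (suc j) (suc (l * m))
             (s≤s (≤-trans (*-monoˡ-≤ l j<m) (≤-reflexive (*-comm m l))))) ⟩
      ∑[ j < m ] (suc l ^ suc j) ∎
      where open ≡-Reasoning

module Fractions where
  open import Data.Nat as ℕ using (ℕ; suc)
  open import Data.Integer as ℤ using (+_; +≤+)
  open import Data.Integer.Properties using (pos-*; pos-+)
  open import Data.Rational using (0ℚ; 1ℚ; _≤_; _+_; _*_; _-_; ∣_∣; 1/_; NonZero; Positive; toℚᵘ)
  open import Data.Rational.Properties
    using (toℚᵘ-fromℚᵘ; toℚᵘ-cancel-≤; toℚᵘ-injective; toℚᵘ-homo-+; toℚᵘ-homo-*; ≤-antisym;
           *-assoc; *-identityˡ; *-identityʳ; *-inverseˡ; +-comm; 0≤p⇒∣p∣≡p; normalize-pos; pos⇒nonZero;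
           +-0-group; module ≤-Reasoning)
  open import Algebra.Properties.Group +-0-group using (//-rightDividesʳ)
  open import Data.Product using (_×_; _,_)
  open import Data.Rational.Unnormalised as ℚᵘ using (mkℚᵘ; _≃_; *≤*)
  import Data.Rational.Unnormalised.Properties as ℚᵘ
  import Data.Nat.Properties as ℕₚ
  open import Data.Nat.Tactic.RingSolver using (solve-∀)
  open import Relation.Binary.PropositionalEquality
    using (_≡_; refl; sym; trans; cong; cong₂; subst; subst₂; module ≡-Reasoning)

  -- frac a (suc b) is definitionally fromℚᵘ (mkℚᵘ (+ a) b).
  toℚᵘ-frac : ∀ a b → toℚᵘ (frac a (suc b)) ≃ mkℚᵘ (+ a) b
  toℚᵘ-frac a b = toℚᵘ-fromℚᵘ (mkℚᵘ (+ a) b)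

  frac-≤ : ∀ a b c d → a ℕ.* suc d ℕ.≤ c ℕ.* suc b → frac a (suc b) ≤ frac c (suc d)
  frac-≤ a b c d ad≤cb = toℚᵘ-cancel-≤
    (ℚᵘ.≤-respˡ-≃ (ℚᵘ.≃-sym (toℚᵘ-frac a b)) (ℚᵘ.≤-respʳ-≃ (ℚᵘ.≃-sym (toℚᵘ-frac c d))
      (*≤* (subst₂ ℤ._≤_ (pos-* a (suc d)) (pos-* c (suc b)) (+≤+ ad≤cb)))))

  frac-≡ : ∀ a b c d → a ℕ.* suc d ≡ c ℕ.* suc b → frac a (suc b) ≡ frac c (suc d)
  frac-≡ a b c d ad≡cb =
    ≤-antisym (frac-≤ a b c d (ℕₚ.≤-reflexive ad≡cb)) (frac-≤ c d a b (ℕₚ.≤-reflexive (sym ad≡cb)))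

  frac-+ : ∀ a b c d → frac a (suc b) + frac c (suc d) ≡ frac (a ℕ.* suc d ℕ.+ c ℕ.* suc b) (suc b ℕ.* suc d)
  frac-+ a b c d = toℚᵘ-injective (ℚᵘ.≃-trans (toℚᵘ-homo-+ (frac a (suc b)) (frac c (suc d)))
    (ℚᵘ.≃-trans (ℚᵘ.+-cong (toℚᵘ-frac a b) (toℚᵘ-frac c d))
    (ℚᵘ.≃-trans (ℚᵘ.≃-reflexive (cong (λ n → mkℚᵘ n _)
       (trans (cong₂ ℤ._+_ (sym (pos-* a (suc d))) (sym (pos-* c (suc b)))) (sym (pos-+ (a ℕ.* suc d) (c ℕ.* suc b))))))
     (ℚᵘ.≃-sym (toℚᵘ-frac _ _)))))

  frac-* : ∀ a b c d → frac a (suc b) * frac c (suc d) ≡ frac (a ℕ.* c) (suc b ℕ.* suc d)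
  frac-* a b c d = toℚᵘ-injective (ℚᵘ.≃-trans (toℚᵘ-homo-* (frac a (suc b)) (frac c (suc d)))
    (ℚᵘ.≃-trans (ℚᵘ.*-cong (toℚᵘ-frac a b) (toℚᵘ-frac c d))
    (ℚᵘ.≃-trans (ℚᵘ.≃-reflexive (cong (λ n → mkℚᵘ n _) (sym (pos-* a c))))
     (ℚᵘ.≃-sym (toℚᵘ-frac _ _)))))

  frac-+-same : ∀ a c d → frac (a ℕ.+ c) (suc d) ≡ frac a (suc d) + frac c (suc d)
  frac-+-same a c d = sym (trans (frac-+ a d c d)
    (frac-≡ (a ℕ.* suc d ℕ.+ c ℕ.* suc d) (d ℕ.+ d ℕ.* suc d) (a ℕ.+ c) d (cross-multiplied a c (suc d))))
    where
    cross-multiplied : ∀ a c e → (a ℕ.* e ℕ.+ c ℕ.* e) ℕ.* e ≡ (a ℕ.+ c) ℕ.* (e ℕ.* e)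
    cross-multiplied = solve-∀

  frac-*-cancel : ∀ p d c → frac (suc p) (suc d) * frac c (suc p) ≡ frac c (suc d)
  frac-*-cancel p d c = trans (frac-* (suc p) d c p)
    (frac-≡ (suc p ℕ.* c) (p ℕ.+ d ℕ.* suc p) c d (cross-multiplied (suc p) (suc d) c))
    where
    cross-multiplied : ∀ a b c → (a ℕ.* c) ℕ.* b ≡ c ℕ.* (b ℕ.* a)
    cross-multiplied = solve-∀

  1/-unique : ∀ p q .{{_ : NonZero p}} → p * q ≡ 1ℚ → 1/ p ≡ q
  1/-unique p q pq≡1 = begin
    1/ p              ≡⟨ *-identityʳ (1/ p) ⟨
    1/ p * 1ℚ         ≡⟨ cong (1/ p *_) pq≡1 ⟨
    1/ p * (p * q)    ≡⟨ *-assoc (1/ p) p q ⟨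
    (1/ p * p) * q    ≡⟨ cong (_* q) (*-inverseˡ p) ⟩
    1ℚ * q            ≡⟨ *-identityˡ q ⟩
    q                 ∎
    where open ≡-Reasoning

  1/-frac : ∀ p d .{{_ : NonZero (frac (suc p) (suc d))}} → 1/ frac (suc p) (suc d) ≡ frac (suc d) (suc p)
  1/-frac p d = 1/-unique _ _ (trans (frac-* (suc p) d (suc d) p)
    (frac-≡ (suc p ℕ.* suc d) (p ℕ.+ d ℕ.* suc p) 1 0 (cross-multiplied (suc p) (suc d))))
    where
    cross-multiplied : ∀ a b → (a ℕ.* b) ℕ.* 1 ≡ 1 ℕ.* (b ℕ.* a)
    cross-multiplied = solve-∀

  frac-nonneg : ∀ a d → 0ℚ ≤ frac a (suc d)
  frac-nonneg a d = frac-≤ 0 0 a d ℕ.z≤n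

  frac≤1/ : ∀ a d n → a ℕ.* suc n ℕ.≤ suc d → frac a (suc d) ≤ frac 1 (suc n)
  frac≤1/ a d n an≤d = frac-≤ a d 1 n (subst (a ℕ.* suc n ℕ.≤_) (sym (ℕₚ.*-identityˡ (suc d))) an≤d)

  frac-self : ∀ p → frac (suc p) (suc p) ≡ 1ℚ
  frac-self p = frac-≡ (suc p) p 1 0 (ℕₚ.*-comm (suc p) 1)

  scale-positive : ∀ {P B D} → 0 ℕ.< P → D ≡ P ℕ.+ B → Positive (frac P D)
  scale-positive {suc p} {B} (ℕ.s≤s ℕ.z≤n) refl = normalize-pos (suc p) (suc (p ℕ.+ B))

  scale-inverse-bound : ∀ {l P B D} → 0 ℕ.< l → (0<P : 0 ℕ.< P) (D≡P+B : D ≡ P ℕ.+ B) → B ℕ.* l ℕ.≤ P →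
    ∣ (1/ frac P D) {{pos⇒nonZero (frac P D) {{scale-positive 0<P D≡P+B}}}} - 1ℚ ∣ ≤ frac 1 l
  scale-inverse-bound {suc l′} {suc p} {B} (ℕ.s≤s ℕ.z≤n) (ℕ.s≤s ℕ.z≤n) refl Bl≤P = begin
    ∣ 1/ frac (suc p) (suc p ℕ.+ B) - 1ℚ ∣          ≡⟨ cong (λ x → ∣ x - 1ℚ ∣) (1/-frac p (p ℕ.+ B)) ⟩
    ∣ frac (suc p ℕ.+ B) (suc p) - 1ℚ ∣             ≡⟨ cong (λ x → ∣ x - 1ℚ ∣) (frac-+-same (suc p) B p) ⟩
    ∣ frac (suc p) (suc p) + frac B (suc p) - 1ℚ ∣  ≡⟨ cong (λ x → ∣ x + frac B (suc p) - 1ℚ ∣) (frac-self p) ⟩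
    ∣ 1ℚ + frac B (suc p) - 1ℚ ∣                    ≡⟨ cong (λ x → ∣ x - 1ℚ ∣) (+-comm 1ℚ (frac B (suc p))) ⟩
    ∣ frac B (suc p) + 1ℚ - 1ℚ ∣                    ≡⟨ cong ∣_∣ (//-rightDividesʳ 1ℚ (frac B (suc p))) ⟩
    ∣ frac B (suc p) ∣                              ≡⟨ 0≤p⇒∣p∣≡p (frac-nonneg B p) ⟩
    frac B (suc p)                                  ≤⟨ frac≤1/ B p l′ Bl≤P ⟩
    frac 1 (suc l′)                                 ∎
    where
    open ≤-Reasoning
    instance
      _ : NonZero (frac (suc p) (suc p ℕ.+ B))
      _ = pos⇒nonZero (frac (suc p) (suc p ℕ.+ B)) {{scale-positive {suc p} {B} (ℕ.s≤s ℕ.z≤n) refl}}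

  excess-bounds : ∀ {l P B D h R c} → 0 ℕ.< l → 0 ℕ.< P → D ≡ P ℕ.+ B → h ≡ R ℕ.+ c → R ℕ.* (l ℕ.* l) ℕ.≤ D →
    0ℚ ≤ frac h D - frac P D * frac c P × frac h D - frac P D * frac c P ≤ frac 1 (l ℕ.* l)
  excess-bounds {suc l′} {suc p} {B} {R = R} {c} (ℕ.s≤s ℕ.z≤n) (ℕ.s≤s ℕ.z≤n) refl refl Rll≤D =
    subst (0ℚ ≤_) (sym excess≡frac) (frac-nonneg R d) ,
    subst (_≤ frac 1 (suc l′ ℕ.* suc l′)) (sym excess≡frac) (frac≤1/ R d _ Rll≤D)
    where
    d = p ℕ.+ B
    excess≡frac : frac (R ℕ.+ c) (suc d) - frac (suc p) (suc d) * frac c (suc p) ≡ frac R (suc d)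
    excess≡frac = begin
      frac (R ℕ.+ c) (suc d) - frac (suc p) (suc d) * frac c (suc p)  ≡⟨ cong₂ _-_ (frac-+-same R c d) (frac-*-cancel p d c) ⟩
      frac R (suc d) + frac c (suc d) - frac c (suc d)                ≡⟨ //-rightDividesʳ (frac c (suc d)) (frac R (suc d)) ⟩
      frac R (suc d)                                                  ∎
      where open ≡-Reasoning

module Masses (l′ m′ : ℕ) where
  open Sums
  open Tuples
  open import Data.Nat using (ℕ; suc; _+_; _*_; _^_; _≤_; _<_)
  open import Data.Nat.Properties
    using (m^n>0; +-comm; *-comm; *-monoˡ-≤; *-monoʳ-≤; <⇒≤; n≤1+n; m≤m+n; ≤-reflexive; module ≤-Reasoning)
  open import Data.Nat.ListAction using (sum)
  open import Data.Nat.Tactic.RingSolver using (solve-∀)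
  open import Data.List using (map; upTo)
  open import Relation.Binary.PropositionalEquality using (_≡_; sym; cong; module ≡-Reasoning)

  l m q : ℕ
  l = suc l′
  m = suc m′
  q = suc l

  P D G : ℕ
  P = q ^ m
  D = sum (map (h l m) (upTo (suc (l * m))))
  G = ∑[ j < m′ ] (q ^ j)

  R : ℕ → ℕ
  R n = ∑[ j < m′ ] countLen l (suc j) n

  0<P : 0 < P
  0<P = m^n>0 q m

  D≡P+qG : D ≡ P + q * G
  D≡P+qG = begin
    D                            ≡⟨ sum-h l m ⟩
    ∑[ j < m ] (q ^ suc j)       ≡⟨ ∑<-suc (λ j → q ^ suc j) m′ ⟩
    ∑[ j < m′ ] (q ^ suc j) + P  ≡⟨ cong (_+ P) (∑<-*ˡ q (q ^_) m′) ⟩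
    q * G + P                    ≡⟨ +-comm (q * G) P ⟩
    P + q * G                    ∎
    where open ≡-Reasoning

  lG<q^m′ : l * G < q ^ m′
  lG<q^m′ = ≤-reflexive (geometric-sum l m′)

  qG*l≤P : q * G * l ≤ P
  qG*l≤P = begin
    q * G * l     ≡⟨ rearrange q G l ⟩
    q * (l * G)   ≤⟨ *-monoʳ-≤ q (<⇒≤ lG<q^m′) ⟩
    P             ∎
    where
    open ≤-Reasoning
    rearrange : ∀ a b c → a * b * c ≡ a * (c * b)
    rearrange = solve-∀

  h≡R+c : ∀ n → h l m n ≡ R n + countLen l m n
  h≡R+c = h-split-last l m′

  R*ll≤D : ∀ n → R n * (l * l) ≤ D
  R*ll≤D n = begin
    R n * (l * l)  ≤⟨ *-monoˡ-≤ (l * l) (∑<-mono m′ (λ j → countLen-suc-≤ l j n)) ⟩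
    G * (l * l)    ≡⟨ rearrange G l ⟩
    l * G * l      ≤⟨ *-monoˡ-≤ l (<⇒≤ lG<q^m′) ⟩
    q ^ m′ * l     ≤⟨ *-monoʳ-≤ (q ^ m′) (n≤1+n l) ⟩
    q ^ m′ * q     ≡⟨ *-comm (q ^ m′) q ⟩
    P              ≤⟨ m≤m+n P (q * G) ⟩
    P + q * G      ≡⟨ sym D≡P+qG ⟩
    D              ∎
    where
    open ≤-Reasoning
    rearrange : ∀ a b → a * (b * b) ≡ b * a * b
    rearrange = solve-∀

open import Data.Nat as ℕ using (ℕ; suc)
open import Data.Product using (Σ; _×_)
open import Data.Rational using (ℚ; 0ℚ; 1ℚ; _<_; _≤_; _*_; _-_; ∣_∣; 1/_; Positive)
open import Data.Rational.Properties using (pos⇒nonZero)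

open import Data.Product using (_,_; map₂)
open import Data.Rational.Properties using (positive⁻¹; ≤-trans; ≤-reflexive; *-identityˡ)
open import Relation.Binary.PropositionalEquality using (sym)
open Fractions using (scale-positive; scale-inverse-bound; excess-bounds)

lemma5 : Σ ℚ λ C → Σ ℚ λ C′ → 0ℚ < C × 0ℚ < C′ ×
           ((l m : ℕ) → 1 ℕ.≤ l → 1 ℕ.≤ m →
             Σ ℚ λ γ → Σ (Positive γ) λ γpos →
               ∣ (1/ γ) {{pos⇒nonZero γ {{γpos}}}} - 1ℚ ∣ ≤ C′ * frac 1 l ×
               ((n : ℕ) → n ℕ.≤ m ℕ.* l →
                 0ℚ ≤ probX l m n - γ * probS l m n ×
                 probX l m n - γ * probS l m n ≤ C * frac 1 (l ℕ.* l)))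
lemma5 = 1ℚ , 1ℚ , positive⁻¹ 1ℚ , positive⁻¹ 1ℚ , λ where
  (suc l′) (suc m′) 0<l _ → let open Masses l′ m′ in
    frac P D ,
    scale-positive 0<P D≡P+qG ,
    ≤-trans (scale-inverse-bound 0<l 0<P D≡P+qG qG*l≤P) (≤-reflexive (sym (*-identityˡ _))) ,
    λ n _ → map₂ (λ e≤ → ≤-trans e≤ (≤-reflexive (sym (*-identityˡ _))))
                 (excess-bounds 0<l 0<P D≡P+qG (h≡R+c n) (R*ll≤D n))
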